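{- Let $G$ be a finite group and $I$ an intersection subgroup of $G$. If $P,Q\in X_I$, then $\delta(P)=\delta(Q)$.
   Context: Let $\mathcal{M}$ be the set of maximal subgroups of $G$; an intersection subgroup is a subgroup of the form $\cap\mathcal{N}$ with $\emptyset\neq\mathcal{N}\subseteq\mathcal{M}$, and $\mathcal{I}$ is the set of these. For $I\in\mathcal{I}$, $X_I$ is the set of subsets of $I$ that are not contained in any $J\in\mathcal{I}$ with $J\subsetneq I$. The deficiency $\delta(P)$ of a subset $P\subseteq G$ is the minimum size of a subset $Q\subseteq G$ such that $\langle P\cup Q\rangle=G$. -}

module Defs where

open import Data.Nat using (ℕ; _≤_)
open import Data.Fin using (Fin)
open import Data.Fin.Subset using (Subset; _∈_; _∉_; _⊆_; _⊂_; _∪_; ⋂; ∣_∣)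
open import Data.List using (List; _∷_)
open import Data.List.Relation.Unary.All using (All)
open import Data.Product using (Σ; ∃; _×_)
open import Data.Sum using (_⊎_)
open import Relation.Nullary using (¬_)
open import Relation.Binary.PropositionalEquality using (_≡_)
open import Algebra.Structures using (IsGroup)

-- A finite group: carrier Fin n (every finite group is isomorphic to one of these),
-- with propositional equality.
record FiniteGroup : Set where
  field
    n     : ℕ
    _∙_   : Fin n → Fin n → Fin n
    ε     : Fin n
    _⁻¹   : Fin n → Fin n
    isGroup : IsGroup _≡_ _∙_ ε _⁻¹

module _ (G : FiniteGroup) where
  open FiniteGroup G

  IsSubgroup : Subset n → Set
  IsSubgroup H = (ε ∈ H) × (∀ {x y} → x ∈ H → y ∈ H → (x ∙ y) ∈ H)
                 × (∀ {x} → x ∈ H → (x ⁻¹) ∈ H)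

  -- ⟨ S ⟩ = G : every subgroup containing S is all of G
  -- (⟨S⟩ is the intersection of all subgroups containing S)
  Generates : Subset n → Set
  Generates S = ∀ H → IsSubgroup H → S ⊆ H → ∀ g → g ∈ H

  IsMaximal : Subset n → Set
  IsMaximal M = IsSubgroup M × (∃ λ g → g ∉ M)
                × (∀ H → IsSubgroup H → M ⊆ H → (H ⊆ M) ⊎ (∀ g → g ∈ H))

  -- I is an intersection subgroup: the intersection of a nonempty (necessarily
  -- finite) family of maximal subgroups
  IsIntersectionSubgroup : Subset n → Set
  IsIntersectionSubgroup I =
    Σ (Subset n) λ M → Σ (List (Subset n)) λ Ms →
      All IsMaximal (M ∷ Ms) × (I ≡ ⋂ (M ∷ Ms))

  InX : Subset n → Subset n → Set
  InX I P = P ⊆ I × (∀ J → IsIntersectionSubgroup J → J ⊂ I → ¬ (P ⊆ J))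

  IsDeficiency : Subset n → ℕ → Set
  IsDeficiency P d = (Σ (Subset n) λ Q → (∣ Q ∣ ≡ d) × Generates (P ∪ Q))
                     × (∀ Q → Generates (P ∪ Q) → d ≤ ∣ Q ∣)

-- A subgroup fails to generate G exactly when it lies in a maximal subgroup. If P ∈ X_I
-- lies in a maximal subgroup M, then so does I, for otherwise M ∩ I would be a smaller
-- intersection subgroup containing P. Hence for every R, P ∪ R generates G iff I ∪ R
-- does, so every P ∈ X_I has the deficiency of I.
module Submission where

open import Defs
open import Data.Nat using (ℕ; _≤_)
open import Data.Nat.Properties using (≤-antisym)
open import Data.Fin.Subset using (Subset; _∈_; _∉_; _⊆_; _⊈_; _⊃_; _∪_; _∩_)
open import Data.Fin.Subset.Properties
  using (_∈?_; _⊂?_; anySubset?; ⊆-trans; p⊂q⇒p⊆q; p⊆p∪q; q⊆p∪q; x∈p∪q⁻; x∈p∩q⁺; x∈p∩q⁻)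
open import Data.Fin.Subset.Induction using (Acc; acc; ⊃-wellFounded)
open import Data.Fin.Properties using (all?; any?; ¬∀⟶∃¬)
open import Data.List using (_∷_)
open import Data.List.Relation.Unary.All using (_∷_)
open import Data.Product using (∃; _×_; _,_; proj₁; proj₂)
open import Data.Sum using (_⊎_; inj₁; inj₂; [_,_])
open import Data.Empty using (⊥-elim)
open import Function using (_∘′_)
open import Relation.Nullary using (Dec; yes; no)
open import Relation.Nullary.Decidable using (_×-dec_; _→-dec_; ¬?; map′)
open import Relation.Binary.PropositionalEquality using (_≡_; refl)

∪-least : ∀ {m} {P R M : Subset m} → P ⊆ M → R ⊆ M → P ∪ R ⊆ M
∪-least {P = P} {R} P⊆M R⊆M x∈P∪R = [ P⊆M , R⊆M ] (x∈p∪q⁻ P R x∈P∪R)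

module _ (G : FiniteGroup) where
  open FiniteGroup G

  IsProperSubgroup : Subset n → Set
  IsProperSubgroup H = IsSubgroup G H × ∃ (_∉ H)

  isSubgroup? : ∀ H → Dec (IsSubgroup G H)
  isSubgroup? H =
    (ε ∈? H)
    ×-dec map′ (λ closed {x} {y} → closed x y) (λ closed x y → closed)
            (all? λ x → all? λ y → (x ∈? H) →-dec ((y ∈? H) →-dec ((x ∙ y) ∈? H)))
    ×-dec map′ (λ closed {x} → closed x) (λ closed x → closed)
            (all? λ x → (x ∈? H) →-dec ((x ⁻¹) ∈? H))

  isProperSubgroup? : ∀ H → Dec (IsProperSubgroup H)
  isProperSubgroup? H = isSubgroup? H ×-dec any? (λ g → ¬? (g ∈? H))

  -- Pass to a strictly larger proper subgroup while one exists; ⊃ is well founded on Subset n.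
  ⊆-maximal : ∀ H → IsProperSubgroup H → ∃ λ M → IsMaximal G M × H ⊆ M
  ⊆-maximal H = climb H (⊃-wellFounded H)
    where
    climb : ∀ H → Acc _⊃_ H → IsProperSubgroup H → ∃ λ M → IsMaximal G M × H ⊆ M
    climb H (acc above) (H≤G , g , g∉H)
      with anySubset? (λ K → isProperSubgroup? K ×-dec H ⊂? K)
    ... | yes (K , K<G , H⊂K) =
      let M , M-max , K⊆M = climb K (above H⊂K) K<G
      in  M , M-max , ⊆-trans (p⊂q⇒p⊆q H⊂K) K⊆M
    ... | no nothing-between = H , (H≤G , (g , g∉H) , maximality) , λ x∈H → x∈H
      where
      maximality : ∀ K → IsSubgroup G K → H ⊆ K → (K ⊆ H) ⊎ (∀ g → g ∈ K)
      maximality K K≤G H⊆K with all? (_∈? K)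
      ... | yes K-full = inj₂ K-full
      ... | no K-not-full = inj₁ K⊆H
        where
        K⊆H : K ⊆ H
        K⊆H {x} x∈K with x ∈? H
        ... | yes x∈H = x∈H
        ... | no x∉H  = ⊥-elim (nothing-between
          (K , (K≤G , ¬∀⟶∃¬ n (_∈ K) (_∈? K) K-not-full) , H⊆K , x , x∈K , x∉H))

  generates-⊆ : ∀ {S T} → S ⊆ T → Generates G S → Generates G T
  generates-⊆ S⊆T S-gen H H≤G T⊆H = S-gen H H≤G (⊆-trans S⊆T T⊆H)

  generates⇒⊈-maximal : ∀ {S M} → Generates G S → IsMaximal G M → S ⊈ M
  generates⇒⊈-maximal S-gen (M≤G , (g , g∉M) , _) S⊆M = g∉M (S-gen _ M≤G S⊆M g)

  ⊈-maximal⇒generates : ∀ S → (∀ M → IsMaximal G M → S ⊈ M) → Generates G S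
  ⊈-maximal⇒generates S S⊈max H H≤G S⊆H g with g ∈? H
  ... | yes g∈H = g∈H
  ... | no g∉H  =
    let M , M-max , H⊆M = ⊆-maximal H (H≤G , g , g∉H)
    in  ⊥-elim (S⊈max M M-max (⊆-trans S⊆H H⊆M))

  ∩-isIntersectionSubgroup : ∀ {M I} → IsMaximal G M → IsIntersectionSubgroup G I →
                             IsIntersectionSubgroup G (M ∩ I)
  ∩-isIntersectionSubgroup M-max (M₀ , Ms , Ms-max , refl) =
    _ , M₀ ∷ Ms , M-max ∷ Ms-max , refl

  InX-⊆-maximal : ∀ {I P M} → IsIntersectionSubgroup G I → InX G I P →
                  IsMaximal G M → P ⊆ M → I ⊆ M
  InX-⊆-maximal {I} {M = M} I-int (P⊆I , P-minimal) M-max P⊆M {x} x∈I with x ∈? M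
  ... | yes x∈M = x∈M
  ... | no x∉M  = ⊥-elim (P-minimal (M ∩ I) (∩-isIntersectionSubgroup M-max I-int)
                          (M∩I⊆I , x , x∈I , λ x∈M∩I → x∉M (proj₁ (x∈p∩q⁻ M I x∈M∩I)))
                          (λ y∈P → x∈p∩q⁺ (P⊆M y∈P , P⊆I y∈P)))
    where
    M∩I⊆I : M ∩ I ⊆ I
    M∩I⊆I y∈M∩I = proj₂ (x∈p∩q⁻ M I y∈M∩I)

  InX-generates : ∀ {I P} R → IsIntersectionSubgroup G I → InX G I P →
                  Generates G (I ∪ R) → Generates G (P ∪ R)
  InX-generates {P = P} R I-int P∈X I∪R-gen = ⊈-maximal⇒generates (P ∪ R) λ M M-max P∪R⊆M →
    generates⇒⊈-maximal I∪R-gen M-max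
      (∪-least (InX-⊆-maximal I-int P∈X M-max (⊆-trans (p⊆p∪q R) P∪R⊆M))
               (⊆-trans (q⊆p∪q P R) P∪R⊆M))

  deficiency-≤ : ∀ {P Q d e} → (∀ R → Generates G (Q ∪ R) → Generates G (P ∪ R)) →
                 IsDeficiency G P d → IsDeficiency G Q e → d ≤ e
  deficiency-≤ Q⇒P (_ , P-least) ((R , refl , Q∪R-gen) , _) = P-least R (Q⇒P R Q∪R-gen)

  InX-deficiency-≤ : ∀ {I P Q d e} → IsIntersectionSubgroup G I → InX G I P → InX G I Q →
                     IsDeficiency G P d → IsDeficiency G Q e → d ≤ e
  InX-deficiency-≤ {I} I-int P∈X (Q⊆I , _) = deficiency-≤ λ R →
    InX-generates R I-int P∈X ∘′ generates-⊆ (∪-least (⊆-trans Q⊆I (p⊆p∪q R)) (q⊆p∪q I R))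

proposition3p2 : (G : FiniteGroup) (I : Subset (FiniteGroup.n G)) →
    IsIntersectionSubgroup G I →
    (P Q : Subset (FiniteGroup.n G)) → InX G I P → InX G I Q →
    (d e : ℕ) → IsDeficiency G P d → IsDeficiency G Q e → d ≡ e
proposition3p2 G I I-int P Q P∈X Q∈X d e δP δQ =
  ≤-antisym (InX-deficiency-≤ G I-int P∈X Q∈X δP δQ) (InX-deficiency-≤ G I-int Q∈X P∈X δQ δP)
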